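{- The class of $1$-perfectly orientable graphs is closed under each of the following operations: (1) disjoint union; (2) adding a universal vertex (join with $K_1$); (3) adding a true twin; (4) adding a simplicial vertex; (5) duplicating a $2$-branch in the complement; (6) vertex deletion; (7) edge contraction.
   Context: All graphs are finite and simple. An orientation of a graph $G$ is $1$-perfect if for every vertex $v$, its out-neighborhood is a clique in $G$; $G$ is $1$-perfectly orientable if it admits a $1$-perfect orientation. Two distinct vertices $u,v$ are true twins if $N[u]=N[v]$ (closed neighborhoods); adding a true twin of $w$ means adding a new vertex $v$ with $N[v]=N[w]\cup\{v\}$ in the new graph. A vertex is simplicial if its neighborhood is a clique, universal if adjacent to all other vertices; adding such a vertex means adding a new vertex with that property. A $2$-branch in a graph $G$ is a path $(a,b,c)$ with $\deg_G(b)=2$ and $\deg_G(c)=1$. Duplicating a $2$-branch $(a,b,c)$ of $G$ produces the graph $H$ with $V(H)=V(G)\cup\{b',c'\}$ ($b',c'$ new), $H-\{b',c'\}=G$, and $(a,b',c')$ a $2$-branch in $H$ (i.e. the only new edges are $ab'$ and $b'c'$). Duplicating a $2$-branch in the complement of $G$ means forming the complement of a graph obtained by duplicating a $2$-branch in $\overline{G}$. Contracting an edge $uv$ of $G$ replaces $u,v$ by a new vertex $w$ adjacent to every vertex of $(N(u)\cup N(v))\setminus\{u,v\}$, all other adjacencies unchanged. -}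

module Defs where

open import Data.Nat using (ℕ; zero; suc; _+_)
open import Data.Bool using (Bool; true; false; _∨_; _∧_; not; if_then_else_)
open import Data.Bool.Properties using (∨-comm)
open import Data.Fin using (Fin; zero; suc; splitAt; punchIn)
open import Data.Fin.Properties using (_≟_)
open import Data.Sum using (_⊎_; inj₁; inj₂)
open import Data.Product using (Σ; _×_; _,_)
open import Data.List using (List; allFin; filter; length)
open import Relation.Nullary using (¬_; yes; no; does)
open import Relation.Nullary.Decidable using (⌊_⌋)
open import Relation.Binary.PropositionalEquality using (_≡_; _≢_; refl; sym; cong)

record Graph (n : ℕ) : Set where
  field
    adj    : Fin n → Fin n → Bool
    adj-sym : ∀ u v → adj u v ≡ adj v u
    adj-irr : ∀ u → adj u u ≡ false
open Graph public

_==_ : ∀ {n} → Fin n → Fin n → Bool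
x == y = does (x ≟ y)

==-sym : ∀ {n} (x y : Fin n) → (x == y) ≡ (y == x)
==-sym x y with x ≟ y | y ≟ x
... | yes _ | yes _ = refl
... | no _  | no _  = refl
... | yes p | no q  = Data.Empty.⊥-elim (q (sym p)) where import Data.Empty
... | no p  | yes q = Data.Empty.⊥-elim (p (sym q)) where import Data.Empty

==-refl : ∀ {n} (x : Fin n) → (x == x) ≡ true
==-refl x with x ≟ x
... | yes _ = refl
... | no q  = Data.Empty.⊥-elim (q refl) where import Data.Empty

record Orientation {n : ℕ} (G : Graph n) : Set where
  field
    arc     : Fin n → Fin n → Bool
    arc⊆adj : ∀ u v → arc u v ≡ true → adj G u v ≡ true
    arc-tot : ∀ u v → adj G u v ≡ true → arc u v ≡ true ⊎ arc v u ≡ true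
    arc-anti : ∀ u v → arc u v ≡ true → arc v u ≡ false
open Orientation public

OnePerfect : ∀ {n} {G : Graph n} → Orientation G → Set
OnePerfect {n} {G} O =
  ∀ v x y → arc O v x ≡ true → arc O v y ≡ true → x ≢ y → adj G x y ≡ true

OnePerfectlyOrientable : ∀ {n} → Graph n → Set
OnePerfectlyOrientable G = Σ (Orientation G) OnePerfect

IsClique : ∀ {n} → Graph n → (Fin n → Bool) → Set
IsClique G S = ∀ x y → S x ≡ true → S y ≡ true → x ≢ y → adj G x y ≡ true

degree : ∀ {n} → Graph n → Fin n → ℕ
degree {n} G v = length (filter (λ x → adj G v x Data.Bool.≟ true) (allFin n))
  where import Data.Bool

Is2Branch : ∀ {n} → Graph n → Fin n → Fin n → Fin n → Set
Is2Branch G a b c =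
  (a ≢ b) × (b ≢ c) × (a ≢ c) ×
  (adj G a b ≡ true) × (adj G b c ≡ true) ×
  (degree G b ≡ 2) × (degree G c ≡ 1)

complement : ∀ {n} → Graph n → Graph n
complement G = record
  { adj = λ u v → not (u == v) ∧ not (adj G u v)
  ; adj-sym = sy
  ; adj-irr = ir }
  where
  sy : ∀ u v → (not (u == v) ∧ not (adj G u v)) ≡ (not (v == u) ∧ not (adj G v u))
  sy u v rewrite ==-sym u v | adj-sym G u v = refl
  ir : ∀ u → (not (u == u) ∧ not (adj G u u)) ≡ false
  ir u rewrite ==-refl u = refl

sumAdj : ∀ {m n} → Graph m → Graph n → Fin m ⊎ Fin n → Fin m ⊎ Fin n → Bool
sumAdj G H (inj₁ x) (inj₁ y) = adj G x y
sumAdj G H (inj₂ x) (inj₂ y) = adj H x y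
sumAdj G H (inj₁ x) (inj₂ y) = false
sumAdj G H (inj₂ x) (inj₁ y) = false

sumAdj-sym : ∀ {m n} (G : Graph m) (H : Graph n) s t → sumAdj G H s t ≡ sumAdj G H t s
sumAdj-sym G H (inj₁ x) (inj₁ y) = adj-sym G x y
sumAdj-sym G H (inj₂ x) (inj₂ y) = adj-sym H x y
sumAdj-sym G H (inj₁ x) (inj₂ y) = refl
sumAdj-sym G H (inj₂ x) (inj₁ y) = refl

sumAdj-irr : ∀ {m n} (G : Graph m) (H : Graph n) s → sumAdj G H s s ≡ false
sumAdj-irr G H (inj₁ x) = adj-irr G x
sumAdj-irr G H (inj₂ x) = adj-irr H x

disjointUnion : ∀ {m n} → Graph m → Graph n → Graph (m + n)
disjointUnion {m} G H = record
  { adj = λ u v → sumAdj G H (splitAt m u) (splitAt m v)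
  ; adj-sym = λ u v → sumAdj-sym G H (splitAt m u) (splitAt m v)
  ; adj-irr = λ u → sumAdj-irr G H (splitAt m u) }

-- Adding a new vertex (vertex 0 of Fin (suc n)) whose neighbourhood is
-- the set S of old vertices; old vertex x becomes suc x.

extAdj : ∀ {n} → Graph n → (Fin n → Bool) → Fin (suc n) → Fin (suc n) → Bool
extAdj G S zero zero = false
extAdj G S zero (suc y) = S y
extAdj G S (suc x) zero = S x
extAdj G S (suc x) (suc y) = adj G x y

addVertex : ∀ {n} → Graph n → (Fin n → Bool) → Graph (suc n)
addVertex G S = record { adj = extAdj G S ; adj-sym = sy ; adj-irr = ir }
  where
  sy : ∀ u v → extAdj G S u v ≡ extAdj G S v u
  sy zero zero = refl
  sy zero (suc y) = refl
  sy (suc x) zero = refl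
  sy (suc x) (suc y) = adj-sym G x y
  ir : ∀ u → extAdj G S u u ≡ false
  ir zero = refl
  ir (suc x) = adj-irr G x

addUniversal : ∀ {n} → Graph n → Graph (suc n)
addUniversal G = addVertex G (λ _ → true)

addTrueTwin : ∀ {n} → Graph n → Fin n → Graph (suc n)
addTrueTwin G w = addVertex G (λ x → adj G w x ∨ (x == w))

addSimplicial : ∀ {n} (G : Graph n) (S : Fin n → Bool) → IsClique G S → Graph (suc n)
addSimplicial G S _ = addVertex G S

-- (5) Duplicating a 2-branch (a , b , c): new vertices b' = 0, c' = 1,
-- new edges a b' and b' c' only.  (Depends only on a.)

dupAdj : ∀ {n} → Graph n → Fin n → Fin (suc (suc n)) → Fin (suc (suc n)) → Bool
dupAdj G a zero zero = false
dupAdj G a zero (suc zero) = true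
dupAdj G a zero (suc (suc y)) = y == a
dupAdj G a (suc zero) zero = true
dupAdj G a (suc zero) (suc zero) = false
dupAdj G a (suc zero) (suc (suc y)) = false
dupAdj G a (suc (suc x)) zero = x == a
dupAdj G a (suc (suc x)) (suc zero) = false
dupAdj G a (suc (suc x)) (suc (suc y)) = adj G x y

duplicate2Branch : ∀ {n} (G : Graph n) (a b c : Fin n) → Is2Branch G a b c →
                   Graph (suc (suc n))
duplicate2Branch G a b c _ = record { adj = dupAdj G a ; adj-sym = sy ; adj-irr = ir }
  where
  sy : ∀ u v → dupAdj G a u v ≡ dupAdj G a v u
  sy zero zero = refl
  sy zero (suc zero) = refl
  sy zero (suc (suc y)) = refl
  sy (suc zero) zero = refl
  sy (suc zero) (suc zero) = refl
  sy (suc zero) (suc (suc y)) = refl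
  sy (suc (suc x)) zero = refl
  sy (suc (suc x)) (suc zero) = refl
  sy (suc (suc x)) (suc (suc y)) = adj-sym G x y
  ir : ∀ u → dupAdj G a u u ≡ false
  ir zero = refl
  ir (suc zero) = refl
  ir (suc (suc x)) = adj-irr G x

duplicate2BranchCompl : ∀ {n} (G : Graph n) (a b c : Fin n) →
                        Is2Branch (complement G) a b c → Graph (suc (suc n))
duplicate2BranchCompl G a b c br = complement (duplicate2Branch (complement G) a b c br)

deleteVertex : ∀ {n} → Graph (suc n) → Fin (suc n) → Graph n
deleteVertex G v = record
  { adj = λ x y → adj G (punchIn v x) (punchIn v y)
  ; adj-sym = λ x y → adj-sym G (punchIn v x) (punchIn v y)
  ; adj-irr = λ x → adj-irr G (punchIn v x) }

-- (7) Edge contraction of an edge uv: vertex v is removed (remaining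
-- vertices punchIn v x), and u plays the role of the new vertex w,
-- adjacent to (N(u) ∪ N(v)) ∖ {u, v}; other adjacencies unchanged.

mergeAdj : ∀ {n} → Graph n → Fin n → Fin n → Fin n → Fin n → Bool
mergeAdj G u v p q =
  if p == u then (adj G u q ∨ adj G v q)
  else (if q == u then (adj G p u ∨ adj G p v) else adj G p q)

mergeAdj-sym : ∀ {n} (G : Graph n) u v p q → mergeAdj G u v p q ≡ mergeAdj G u v q p
mergeAdj-sym G u v p q with p ≟ u | q ≟ u
... | yes refl | yes refl = refl
... | yes refl | no _ rewrite adj-sym G u q | adj-sym G v q = refl
... | no _ | yes refl rewrite adj-sym G p u | adj-sym G p v = refl
... | no _ | no _ = adj-sym G p q

contractAdj : ∀ {n} → Graph (suc n) → Fin (suc n) → Fin (suc n) → Fin n → Fin n → Bool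
contractAdj G u v x y =
  if x == y then false else mergeAdj G u v (punchIn v x) (punchIn v y)

contractEdge : ∀ {n} (G : Graph (suc n)) (u v : Fin (suc n)) → adj G u v ≡ true →
               Graph n
contractEdge G u v _ = record { adj = contractAdj G u v ; adj-sym = sy ; adj-irr = ir }
  where
  sy : ∀ x y → contractAdj G u v x y ≡ contractAdj G u v y x
  sy x y rewrite ==-sym x y
               | mergeAdj-sym G u v (punchIn v x) (punchIn v y) = refl
  ir : ∀ x → contractAdj G u v x x ≡ false
  ir x rewrite ==-refl x = refl

-- Everything reduces to two constructions on 1-perfect orientations.  Extension: a new vertex
-- with neighbourhood S may send arcs to a clique T ⊆ S and receive arcs from S ∖ T; the result is
-- 1-perfect provided every out-neighbour of a vertex of S ∖ T lies in S.  Pullback: a 1-perfect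
-- orientation restricts to every induced subgraph.
--
-- A universal vertex takes T = ∅, a simplicial vertex T = S, a true twin of w takes T = {w} ∪ N⁺(w),
-- and deletion is a pullback.  The contraction G/uv is an induced subgraph of G + w with
-- N(w) = N(u) ∪ N(v), where T consists of the vertices of N(w) pointing to neither u nor v.
-- Duplicating a 2-branch (a, b, c) of the complement adds c′ adjacent to all of G, then b′ adjacent
-- to all of G but a; in G, b is adjacent to everything except a and c, and c to everything except
-- b.  After reorienting ac as a → c both steps are extensions, with T = {b} ∪ N⁺(c) and
-- T = {c} ∪ N⁺(b).

module Submission where

open import Defs
open import Data.Nat using (ℕ; suc; _+_; s≤s)
import Data.Nat as ℕ
open import Data.Bool using (Bool; true; false; _∨_; _∧_; not; if_then_else_)
import Data.Bool as Bool
open import Data.Bool.Properties using (not-involutive; ∧-zeroʳ)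
open import Data.Nat.Properties using (n<1+n)
open import Data.Fin using (Fin; zero; suc; splitAt; join; punchIn)
import Data.Fin as Fin
open import Data.Fin.Properties using (_≟_; punchIn-injective; join-splitAt; pigeonhole; suc-injective)
open import Data.List using (List; lookup; length)
open import Data.List.Membership.Propositional using (_∈_)
open import Data.List.Membership.Propositional.Properties using (∈-filter⁺; ∈-allFin)
open import Data.List.Relation.Unary.Any using (index)
open import Data.List.Relation.Unary.Any.Properties using (lookup-index)
open import Data.Product using (∃₂; _×_; _,_; proj₁; proj₂)
open import Data.Sum using (_⊎_; inj₁; inj₂)
open import Data.Empty using (⊥; ⊥-elim)
open import Data.Vec.Functional using ([]; _∷_)
open import Function using (_∘_; id; case_of_)
open import Function.Definitions using (Injective)
open import Relation.Nullary using (yes; no)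
open import Relation.Nullary.Decidable using (toSum)
open import Relation.Binary.PropositionalEquality
  using (_≡_; _≢_; refl; sym; trans; cong; cong₂; subst)

private
  variable
    m n : ℕ

true≢false : ∀ {b} → b ≡ true → b ≡ false → ⊥
true≢false refl ()

∨-true : ∀ {a b} → a ∨ b ≡ true → a ≡ true ⊎ b ≡ true
∨-true {true}  _ = inj₁ refl
∨-true {false} e = inj₂ e

∨-trueˡ : ∀ {a} b → a ≡ true → a ∨ b ≡ true
∨-trueˡ b refl = refl

∨-trueʳ : ∀ a {b} → b ≡ true → a ∨ b ≡ true
∨-trueʳ true  _ = refl
∨-trueʳ false e = e

∨-false : ∀ {a b} → a ∨ b ≡ false → a ≡ false × b ≡ false
∨-false {false} e = refl , e

∧-true : ∀ {a b} → a ∧ b ≡ true → a ≡ true × b ≡ true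
∧-true {true} e = refl , e

∧-not-false : ∀ {a b} → a ≡ true → a ∧ not b ≡ false → b ≡ true
∧-not-false {b = true} refl _ = refl

not-true : ∀ {a} → not a ≡ true → a ≡ false
not-true {false} _ = refl

==⇒≡ : {x y : Fin n} → (x == y) ≡ true → x ≡ y
==⇒≡ {x = x} {y} e with x ≟ y
... | yes x≡y = x≡y

≢⇒==-false : {x y : Fin n} → x ≢ y → (x == y) ≡ false
≢⇒==-false {x = x} {y} x≢y with x ≟ y
... | yes x≡y = ⊥-elim (x≢y x≡y)
... | no  _   = refl

==-false⇒≢ : {x y : Fin n} → (x == y) ≡ false → x ≢ y
==-false⇒≢ {x = x} e refl = true≢false (==-refl x) e

≢⇒not==-true : {x y : Fin n} → x ≢ y → not (x == y) ≡ true
≢⇒not==-true = cong not ∘ ≢⇒==-false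

not==-true⇒≢ : {x y : Fin n} → not (x == y) ≡ true → x ≢ y
not==-true⇒≢ = ==-false⇒≢ ∘ not-true

adj⇒≢ : (G : Graph n) {x y : Fin n} → adj G x y ≡ true → x ≢ y
adj⇒≢ G {x} e refl = true≢false e (adj-irr G x)

module _ {G : Graph n} (O : Orientation G) where

  arc⇒≢ : ∀ {x y} → arc O x y ≡ true → x ≢ y
  arc⇒≢ {x} {y} e = adj⇒≢ G (arc⊆adj O x y e)

  arc-reverse : ∀ {x y} → adj G x y ≡ true → arc O x y ≡ false → arc O y x ≡ true
  arc-reverse {x} {y} e x↛y with arc-tot O x y e
  ... | inj₁ x→y = ⊥-elim (true≢false x→y x↛y)
  ... | inj₂ y→x = y→x

pigeonhole-∈ : ∀ {a} {A : Set a} {k} (xs : List A) (f : Fin k → A) →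
               (∀ i → f i ∈ xs) → length xs ℕ.< k → ∃₂ λ i j → i Fin.< j × f i ≡ f j
pigeonhole-∈ xs f f∈xs |xs|<k =
  let i , j , i<j , same-index = pigeonhole |xs|<k (index ∘ f∈xs) in
  i , j , i<j ,
  trans (lookup-index (f∈xs i)) (trans (cong (lookup xs) same-index) (sym (lookup-index (f∈xs j))))

neighbours-collide : ∀ {k} (G : Graph n) v (f : Fin k → Fin n) →
                     (∀ i → adj G v (f i) ≡ true) → degree G v ℕ.< k →
                     ∃₂ λ i j → i Fin.< j × f i ≡ f j
neighbours-collide G v f v~f = pigeonhole-∈ _ f λ i →
  ∈-filter⁺ (λ x → adj G v x Bool.≟ true) (∈-allFin (f i)) (v~f i)

pullback-orientable : (G : Graph m) (H : Graph n) (f : Fin n → Fin m) → Injective _≡_ _≡_ f →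
                      (∀ x y → adj H x y ≡ adj G (f x) (f y)) →
                      OnePerfectlyOrientable G → OnePerfectlyOrientable H
pullback-orientable G H f f-inj adj-f (O , perfect) = O′ , perfect′
  where
  O′ : Orientation H
  O′ = record
    { arc      = λ x y → arc O (f x) (f y)
    ; arc⊆adj  = λ x y x→y → trans (adj-f x y) (arc⊆adj O (f x) (f y) x→y)
    ; arc-tot  = λ x y x~y → arc-tot O (f x) (f y) (trans (sym (adj-f x y)) x~y)
    ; arc-anti = λ x y → arc-anti O (f x) (f y)
    }
  perfect′ : OnePerfect O′
  perfect′ s x y s→x s→y x≢y = trans (adj-f x y) (perfect (f s) (f x) (f y) s→x s→y (x≢y ∘ f-inj))

module Extension {G : Graph n} (O : Orientation G) (S T : Fin n → Bool)
                 (T⊆S : ∀ x → T x ≡ true → S x ≡ true) where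

  extendArc : Fin (suc n) → Fin (suc n) → Bool
  extendArc zero    zero    = false
  extendArc zero    (suc y) = T y
  extendArc (suc x) zero    = S x ∧ not (T x)
  extendArc (suc x) (suc y) = arc O x y

  private
    sub : ∀ u v → extendArc u v ≡ true → adj (addVertex G S) u v ≡ true
    sub zero    (suc y) = T⊆S y
    sub (suc x) zero    = proj₁ ∘ ∧-true
    sub (suc x) (suc y) = arc⊆adj O x y

    new-edge : ∀ y → S y ≡ true → T y ≡ true ⊎ S y ∧ not (T y) ≡ true
    new-edge y Sy with T y
    ... | true  = inj₁ refl
    ... | false = inj₂ (cong (_∧ true) Sy)

    total : ∀ u v → adj (addVertex G S) u v ≡ true → extendArc u v ≡ true ⊎ extendArc v u ≡ true
    total zero    (suc y) Sy = new-edge y Sy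
    total (suc x) zero    Sx with new-edge x Sx
    ... | inj₁ 0→x = inj₂ 0→x
    ... | inj₂ x→0 = inj₁ x→0
    total (suc x) (suc y) = arc-tot O x y

    anti : ∀ u v → extendArc u v ≡ true → extendArc v u ≡ false
    anti zero    (suc y) Ty rewrite Ty = ∧-zeroʳ (S y)
    anti (suc x) zero    e = not-true (proj₂ (∧-true {S x} e))
    anti (suc x) (suc y) = arc-anti O x y

  extend : Orientation (addVertex G S)
  extend = record { arc = extendArc ; arc⊆adj = sub ; arc-tot = total ; arc-anti = anti }

  extend-perfect : OnePerfect O → IsClique G T →
                   (∀ x y → S x ≡ true → T x ≡ false → arc O x y ≡ true → S y ≡ true) →
                   OnePerfect extend
  extend-perfect _ T-clique _ zero (suc x) (suc y) Tx Ty x≢y = T-clique x y Tx Ty (x≢y ∘ cong suc)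
  extend-perfect _ _ _ (suc s) zero zero _ _ x≢y = ⊥-elim (x≢y refl)
  extend-perfect _ _ in-closed (suc s) zero (suc y) s→0 s→y _ =
    let Ss , ¬Ts = ∧-true {S s} s→0 in in-closed s y Ss (not-true ¬Ts) s→y
  extend-perfect _ _ in-closed (suc s) (suc x) zero s→x s→0 _ =
    let Ss , ¬Ts = ∧-true {S s} s→0 in in-closed s x Ss (not-true ¬Ts) s→x
  extend-perfect perfect _ _ (suc s) (suc x) (suc y) s→x s→y x≢y = perfect s x y s→x s→y (x≢y ∘ cong suc)

insert-out-clique : {G : Graph n} (O : Orientation G) → OnePerfect O → ∀ w v →
                    (∀ y → arc O w y ≡ true → y ≢ v → adj G v y ≡ true) →
                    IsClique G (λ y → (y == v) ∨ arc O w y)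
insert-out-clique {G = G} O perfect w v v~out[w] x y ex ey x≢y with ∨-true ex | ∨-true ey
... | inj₁ x=v | inj₁ y=v = ⊥-elim (x≢y (trans (==⇒≡ x=v) (sym (==⇒≡ y=v))))
... | inj₁ x=v | inj₂ w→y =
  subst (λ z → adj G z y ≡ true) (sym (==⇒≡ x=v)) (v~out[w] y w→y (λ y≡v → x≢y (trans (==⇒≡ x=v) (sym y≡v))))
... | inj₂ w→x | inj₁ y=v =
  subst (λ z → adj G x z ≡ true) (sym (==⇒≡ y=v))
        (trans (adj-sym G x v) (v~out[w] x w→x (λ x≡v → x≢y (trans x≡v (sym (==⇒≡ y=v))))))
... | inj₂ w→x | inj₂ w→y = perfect w x y w→x w→y x≢y

disjointUnion-orientable : (G : Graph m) (H : Graph n) →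
                           OnePerfectlyOrientable G → OnePerfectlyOrientable H →
                           OnePerfectlyOrientable (disjointUnion G H)
disjointUnion-orientable {m} {n} G H (O₁ , perfect₁) (O₂ , perfect₂) = O , perfect
  where
  sumArc : Fin m ⊎ Fin n → Fin m ⊎ Fin n → Bool
  sumArc (inj₁ x) (inj₁ y) = arc O₁ x y
  sumArc (inj₂ x) (inj₂ y) = arc O₂ x y
  sumArc _        _        = false

  sub : ∀ s t → sumArc s t ≡ true → sumAdj G H s t ≡ true
  sub (inj₁ x) (inj₁ y) = arc⊆adj O₁ x y
  sub (inj₂ x) (inj₂ y) = arc⊆adj O₂ x y

  total : ∀ s t → sumAdj G H s t ≡ true → sumArc s t ≡ true ⊎ sumArc t s ≡ true
  total (inj₁ x) (inj₁ y) = arc-tot O₁ x y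
  total (inj₂ x) (inj₂ y) = arc-tot O₂ x y

  anti : ∀ s t → sumArc s t ≡ true → sumArc t s ≡ false
  anti (inj₁ x) (inj₁ y) = arc-anti O₁ x y
  anti (inj₂ x) (inj₂ y) = arc-anti O₂ x y

  sum-perfect : ∀ r s t → sumArc r s ≡ true → sumArc r t ≡ true → s ≢ t → sumAdj G H s t ≡ true
  sum-perfect (inj₁ r) (inj₁ x) (inj₁ y) r→x r→y x≢y = perfect₁ r x y r→x r→y (x≢y ∘ cong inj₁)
  sum-perfect (inj₂ r) (inj₂ x) (inj₂ y) r→x r→y x≢y = perfect₂ r x y r→x r→y (x≢y ∘ cong inj₂)

  split : Fin (m + n) → Fin m ⊎ Fin n
  split = splitAt m

  O : Orientation (disjointUnion G H)
  O = record
    { arc      = λ u v → sumArc (split u) (split v)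
    ; arc⊆adj  = λ u v → sub (split u) (split v)
    ; arc-tot  = λ u v → total (split u) (split v)
    ; arc-anti = λ u v → anti (split u) (split v)
    }

  split-injective : Injective _≡_ _≡_ split
  split-injective {u} {v} e = trans (sym (join-splitAt m n u)) (trans (cong (join m n) e) (join-splitAt m n v))

  perfect : OnePerfect O
  perfect r u v r→u r→v u≢v = sum-perfect (split r) (split u) (split v) r→u r→v (u≢v ∘ split-injective)

addUniversal-orientable : (G : Graph n) → OnePerfectlyOrientable G → OnePerfectlyOrientable (addUniversal G)
addUniversal-orientable G (O , perfect) =
  extend , extend-perfect perfect (λ _ _ ()) (λ _ _ _ _ _ → refl)
  where open Extension O (λ _ → true) (λ _ → false) (λ _ ())

addSimplicial-orientable : (G : Graph n) (S : Fin n → Bool) (S-clique : IsClique G S) →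
                           OnePerfectlyOrientable G → OnePerfectlyOrientable (addSimplicial G S S-clique)
addSimplicial-orientable G S S-clique (O , perfect) =
  extend , extend-perfect perfect S-clique (λ x _ Sx ¬Sx _ → ⊥-elim (true≢false Sx ¬Sx))
  where open Extension O S S (λ _ Sx → Sx)

addTrueTwin-orientable : (G : Graph n) (w : Fin n) →
                         OnePerfectlyOrientable G → OnePerfectlyOrientable (addTrueTwin G w)
addTrueTwin-orientable {n} G w (O , perfect) =
  extend , extend-perfect perfect (insert-out-clique O perfect w w (λ y w→y _ → arc⊆adj O w y w→y)) in-closed
  where
  N[w] out[w] : Fin n → Bool
  N[w]   x = adj G w x ∨ (x == w)
  out[w] x = (x == w) ∨ arc O w x

  out⊆N : ∀ x → out[w] x ≡ true → N[w] x ≡ true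
  out⊆N x e with ∨-true e
  ... | inj₁ x=w = ∨-trueʳ _ x=w
  ... | inj₂ w→x = ∨-trueˡ _ (arc⊆adj O w x w→x)

  open Extension O N[w] out[w] out⊆N

  in-closed : ∀ x y → N[w] x ≡ true → out[w] x ≡ false → arc O x y ≡ true → N[w] y ≡ true
  in-closed x y ex ¬ex x→y with ∨-false {x == w} ¬ex | ∨-true ex
  ... | x≠w , _ | inj₂ x=w = ⊥-elim (true≢false x=w x≠w)
  ... | _ , w↛x | inj₁ w~x with toSum (y ≟ w)
  ...   | inj₁ refl = ∨-trueʳ _ (==-refl y)
  ...   | inj₂ y≢w  = ∨-trueˡ _ (perfect x w y (arc-reverse O w~x w↛x) x→y (y≢w ∘ sym))

deleteVertex-orientable : (G : Graph (suc n)) (v : Fin (suc n)) →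
                          OnePerfectlyOrientable G → OnePerfectlyOrientable (deleteVertex G v)
deleteVertex-orientable G v =
  pullback-orientable G (deleteVertex G v) (punchIn v) (punchIn-injective v _ _) (λ _ _ → refl)

module Contraction (G : Graph (suc n)) (u v : Fin (suc n)) (u~v : adj G u v ≡ true) where

  N[uv] : Fin (suc n) → Bool
  N[uv] x = adj G u x ∨ adj G v x

  G⁺ : Graph (suc (suc n))
  G⁺ = addVertex G N[uv]

  embed : Fin (suc n) → Fin (suc (suc n))
  embed p = if p == u then zero else suc p

  embed-injective : Injective _≡_ _≡_ embed
  embed-injective {p} {q} e with p ≟ u | q ≟ u
  ... | yes p≡u | yes q≡u = trans p≡u (sym q≡u)
  ... | yes _   | no  _   = case e of λ ()
  ... | no  _   | yes _   = case e of λ ()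
  ... | no  _   | no  _   = suc-injective e

  merge-embed : ∀ p q → p ≢ q → mergeAdj G u v p q ≡ adj G⁺ (embed p) (embed q)
  merge-embed p q p≢q with p ≟ u | q ≟ u
  ... | yes refl | yes refl = ⊥-elim (p≢q refl)
  ... | yes refl | no  _    = refl
  ... | no  _    | yes refl = cong₂ _∨_ (adj-sym G p u) (adj-sym G p v)
  ... | no  _    | no  _    = refl

  contract-embed : ∀ x y → adj (contractEdge G u v u~v) x y ≡
                           adj G⁺ (embed (punchIn v x)) (embed (punchIn v y))
  contract-embed x y with x ≟ y
  ... | yes refl = sym (adj-irr G⁺ (embed (punchIn v x)))
  ... | no  x≢y  = merge-embed (punchIn v x) (punchIn v y) (x≢y ∘ punchIn-injective v x y)

  module _ (O : Orientation G) where

    into-uv : Fin (suc n) → Bool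
    into-uv x = arc O x u ∨ arc O x v

    T : Fin (suc n) → Bool
    T x = N[uv] x ∧ not (into-uv x)

    T⊆N[uv] : ∀ x → T x ≡ true → N[uv] x ≡ true
    T⊆N[uv] x Tx = let N[uv]x , _ = ∧-true Tx in N[uv]x

    T-from-uv : ∀ {x} → T x ≡ true → arc O u x ≡ true ⊎ arc O v x ≡ true
    T-from-uv {x} Tx with ∧-true {N[uv] x} Tx
    ... | N[uv]x , ¬into with ∨-false {arc O x u} (not-true ¬into) | ∨-true N[uv]x
    ...   | x↛u , _ | inj₁ u~x = inj₁ (arc-reverse O (trans (adj-sym G x u) u~x) x↛u)
    ...   | _ , x↛v | inj₂ v~x = inj₂ (arc-reverse O (trans (adj-sym G x v) v~x) x↛v)

    not-into : ∀ {x} → T x ≡ true → arc O x u ≡ false × arc O x v ≡ false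
    not-into {x} Tx = let _ , ¬into = ∧-true {N[uv] x} Tx in ∨-false (not-true ¬into)

  module _ (O : Orientation G) (perfect : OnePerfect O) where

    -- Whichever way uv is oriented, one of x, y is an out-neighbour of both u and v.
    across : ∀ {x y} → arc O u x ≡ true → arc O v y ≡ true → arc O x v ≡ false → arc O y u ≡ false →
             x ≢ y → adj G x y ≡ true
    across {x} {y} u→x v→y x↛v y↛u x≢y with arc-tot O u v u~v
    ... | inj₁ u→v with x ≟ v
    ...   | yes refl = arc⊆adj O v y v→y
    ...   | no  x≢v  = perfect v x y (arc-reverse O (perfect u x v u→x u→v x≢v) x↛v) v→y x≢y
    across {x} {y} u→x v→y x↛v y↛u x≢y | inj₂ v→u with y ≟ u
    ...   | yes refl = trans (adj-sym G x u) (arc⊆adj O u x u→x)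
    ...   | no  y≢u  = perfect u x y u→x (arc-reverse O (perfect v y u v→y v→u y≢u) y↛u) x≢y

    T-clique : IsClique G (T O)
    T-clique x y Tx Ty x≢y with T-from-uv O Tx | T-from-uv O Ty
    ... | inj₁ u→x | inj₁ u→y = perfect u x y u→x u→y x≢y
    ... | inj₂ v→x | inj₂ v→y = perfect v x y v→x v→y x≢y
    ... | inj₁ u→x | inj₂ v→y = across u→x v→y (proj₂ (not-into O Tx)) (proj₁ (not-into O Ty)) x≢y
    ... | inj₂ v→x | inj₁ u→y =
      trans (adj-sym G x y) (across u→y v→x (proj₂ (not-into O Ty)) (proj₁ (not-into O Tx)) (x≢y ∘ sym))

    in-closed : ∀ x y → N[uv] x ≡ true → T O x ≡ false → arc O x y ≡ true → N[uv] y ≡ true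
    in-closed x y N[uv]x ¬Tx x→y with ∨-true (∧-not-false N[uv]x ¬Tx)
    ... | inj₁ x→u with y ≟ u
    ...   | yes refl = ∨-trueʳ _ (trans (adj-sym G v u) u~v)
    ...   | no  y≢u  = ∨-trueˡ _ (perfect x u y x→u x→y (y≢u ∘ sym))
    in-closed x y N[uv]x ¬Tx x→y | inj₂ x→v with y ≟ v
    ...   | yes refl = ∨-trueˡ _ u~v
    ...   | no  y≢v  = ∨-trueʳ _ (perfect x v y x→v x→y (y≢v ∘ sym))

  G⁺-orientable : OnePerfectlyOrientable G → OnePerfectlyOrientable G⁺
  G⁺-orientable (O , perfect) = extend , extend-perfect perfect (T-clique O perfect) (in-closed O perfect)
    where open Extension O N[uv] (T O) (T⊆N[uv] O)

contractEdge-orientable : (G : Graph (suc n)) (u v : Fin (suc n)) (u~v : adj G u v ≡ true) →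
                          OnePerfectlyOrientable G → OnePerfectlyOrientable (contractEdge G u v u~v)
contractEdge-orientable G u v u~v =
  pullback-orientable G⁺ (contractEdge G u v u~v) (embed ∘ punchIn v)
    (punchIn-injective v _ _ ∘ embed-injective) contract-embed
  ∘ G⁺-orientable
  where open Contraction G u v u~v

module Reorientation {G : Graph n} (O : Orientation G) {p q : Fin n} (p~q : adj G p q ≡ true) where

  private
    p≢q : p ≢ q
    p≢q = adj⇒≢ G p~q

    isPQ : Fin n → Fin n → Bool
    isPQ x y = (x == p) ∧ (y == q)

    reArc : Fin n → Fin n → Bool
    reArc x y = isPQ x y ∨ (not (isPQ y x) ∧ arc O x y)

    data Pair (x y : Fin n) : Set where
      forward  : x ≡ p → y ≡ q → Pair x y
      backward : x ≡ q → y ≡ p → Pair x y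
      other    : isPQ x y ≡ false → isPQ y x ≡ false → Pair x y

    pair : ∀ x y → Pair x y
    pair x y with isPQ x y in xy | isPQ y x in yx
    ... | true  | _     = let x=p , y=q = ∧-true xy in forward (==⇒≡ x=p) (==⇒≡ y=q)
    ... | false | true  = let y=p , x=q = ∧-true yx in backward (==⇒≡ x=q) (==⇒≡ y=p)
    ... | false | false = other xy yx

    reArc-pq : reArc p q ≡ true
    reArc-pq rewrite ==-refl p | ==-refl q = refl

    reArc-qp : reArc q p ≡ false
    reArc-qp rewrite ≢⇒==-false (p≢q ∘ sym) | ==-refl p | ==-refl q = refl

    reArc-other : ∀ {x y} → isPQ x y ≡ false → isPQ y x ≡ false → reArc x y ≡ arc O x y
    reArc-other xy yx rewrite xy | yx = refl

    sub : ∀ x y → reArc x y ≡ true → adj G x y ≡ true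
    sub x y e with pair x y
    ... | forward  refl refl = p~q
    ... | backward refl refl = ⊥-elim (true≢false e reArc-qp)
    ... | other xy yx        = arc⊆adj O x y (trans (sym (reArc-other xy yx)) e)

    total : ∀ x y → adj G x y ≡ true → reArc x y ≡ true ⊎ reArc y x ≡ true
    total x y x~y with pair x y
    ... | forward  refl refl = inj₁ reArc-pq
    ... | backward refl refl = inj₂ reArc-pq
    ... | other xy yx with arc-tot O x y x~y
    ...   | inj₁ x→y = inj₁ (trans (reArc-other xy yx) x→y)
    ...   | inj₂ y→x = inj₂ (trans (reArc-other yx xy) y→x)

    anti : ∀ x y → reArc x y ≡ true → reArc y x ≡ false
    anti x y e with pair x y
    ... | forward  refl refl = reArc-qp
    ... | backward refl refl = ⊥-elim (true≢false e reArc-qp)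
    ... | other xy yx        = trans (reArc-other yx xy) (arc-anti O x y (trans (sym (reArc-other xy yx)) e))

  reorient : Orientation G
  reorient = record { arc = reArc ; arc⊆adj = sub ; arc-tot = total ; arc-anti = anti }

  reorient-arc : arc reorient p q ≡ true
  reorient-arc = reArc-pq

  private
    out-of-p : ∀ {x} → reArc p x ≡ true → x ≡ q ⊎ arc O p x ≡ true
    out-of-p {x} e with pair p x
    ... | forward  _   x≡q = inj₁ x≡q
    ... | backward p≡q _   = ⊥-elim (p≢q p≡q)
    ... | other px xp      = inj₂ (trans (sym (reArc-other px xp)) e)

    out-of-other : ∀ {s x} → s ≢ p → reArc s x ≡ true → arc O s x ≡ true
    out-of-other {s} {x} s≢p e with pair s x
    ... | forward  s≡p _     = ⊥-elim (s≢p s≡p)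
    ... | backward refl refl = ⊥-elim (true≢false e reArc-qp)
    ... | other sx xs        = trans (sym (reArc-other sx xs)) e

  -- Only p gains an out-neighbour, namely q; the hypothesis makes out(p) ∪ {q} a clique.
  reorient-perfect : OnePerfect O → (∀ y → arc O p y ≡ true → y ≢ q → adj G q y ≡ true) →
                     OnePerfect reorient
  reorient-perfect perfect q~out[p] s x y s→x s→y x≢y with toSum (s ≟ p)
  ... | inj₂ s≢p = perfect s x y (out-of-other s≢p s→x) (out-of-other s≢p s→y) x≢y
  ... | inj₁ refl with out-of-p s→x | out-of-p s→y
  ...   | inj₁ refl | inj₁ refl = ⊥-elim (x≢y refl)
  ...   | inj₁ refl | inj₂ p→y  = q~out[p] y p→y (x≢y ∘ sym)
  ...   | inj₂ p→x  | inj₁ refl = trans (adj-sym G x q) (q~out[p] x p→x x≢y)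
  ...   | inj₂ p→x  | inj₂ p→y  = perfect p x y p→x p→y x≢y

complement-involutive : (G : Graph n) → ∀ x y → adj (complement (complement G)) x y ≡ adj G x y
complement-involutive G x y with x ≟ y
... | yes refl = sym (adj-irr G x)
... | no  _    = not-involutive (adj G x y)

complement-adj : (G : Graph n) {x y : Fin n} → x ≢ y → adj G x y ≡ false → adj (complement G) x y ≡ true
complement-adj G x≢y x≁y rewrite ≢⇒==-false x≢y | x≁y = refl

complement-adj⇒nonadj : (G : Graph n) {x y : Fin n} → adj (complement G) x y ≡ true → adj G x y ≡ false
complement-adj⇒nonadj G {x} e = not-true (proj₂ (∧-true {not (x == _)} e))

allBut : Fin n → Fin (suc n) → Bool
allBut a zero    = false
allBut a (suc y) = not (y == a)

duplicate2BranchCompl-adj : (G : Graph n) (a b c : Fin n) (br : Is2Branch (complement G) a b c) →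
  ∀ p q → adj (duplicate2BranchCompl G a b c br) p q ≡
          adj (addVertex (addVertex G (λ _ → true)) (allBut a)) p q
duplicate2BranchCompl-adj G a b c br zero          zero          = refl
duplicate2BranchCompl-adj G a b c br zero          (suc zero)    = refl
duplicate2BranchCompl-adj G a b c br zero          (suc (suc y)) = refl
duplicate2BranchCompl-adj G a b c br (suc zero)    zero          = refl
duplicate2BranchCompl-adj G a b c br (suc zero)    (suc zero)    = refl
duplicate2BranchCompl-adj G a b c br (suc zero)    (suc (suc y)) = refl
duplicate2BranchCompl-adj G a b c br (suc (suc x)) zero          = refl
duplicate2BranchCompl-adj G a b c br (suc (suc x)) (suc zero)    = refl
duplicate2BranchCompl-adj G a b c br (suc (suc x)) (suc (suc y)) = complement-involutive G x y

module DuplicateCoBranch (G : Graph n) {a b c : Fin n} (a≢b : a ≢ b) (b≢c : b ≢ c) (a≢c : a ≢ c)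
    (co-ab : adj (complement G) a b ≡ true) (co-bc : adj (complement G) b c ≡ true)
    (deg-b : degree (complement G) b ≡ 2) (deg-c : degree (complement G) c ≡ 1) where

  a≁b : adj G a b ≡ false
  a≁b = complement-adj⇒nonadj G co-ab

  b≁c : adj G b c ≡ false
  b≁c = complement-adj⇒nonadj G co-bc

  b≁a : adj G b a ≡ false
  b≁a = trans (adj-sym G b a) a≁b

  c-adjacent : ∀ x → x ≢ b → x ≢ c → adj G c x ≡ true
  c-adjacent x x≢b x≢c with adj G c x in c?x
  ... | true  = refl
  ... | false with neighbours-collide (complement G) c (b ∷ x ∷ []) co-nbr deg<2
    where
    co-nbr : ∀ i → adj (complement G) c ((b ∷ x ∷ []) i) ≡ true
    co-nbr zero       = trans (adj-sym (complement G) c b) co-bc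
    co-nbr (suc zero) = complement-adj G (x≢c ∘ sym) c?x
    deg<2 : degree (complement G) c ℕ.< 2
    deg<2 = subst (ℕ._< 2) (sym deg-c) (n<1+n 1)
  ...   | zero , suc zero , _ , b≡x = ⊥-elim (x≢b (sym b≡x))
  ...   | suc _ , suc zero , s≤s () , _

  b-adjacent : ∀ x → x ≢ a → x ≢ b → x ≢ c → adj G b x ≡ true
  b-adjacent x x≢a x≢b x≢c with adj G b x in b?x
  ... | true  = refl
  ... | false with neighbours-collide (complement G) b (a ∷ c ∷ x ∷ []) co-nbr deg<3
    where
    co-nbr : ∀ i → adj (complement G) b ((a ∷ c ∷ x ∷ []) i) ≡ true
    co-nbr zero             = trans (adj-sym (complement G) b a) co-ab
    co-nbr (suc zero)       = co-bc
    co-nbr (suc (suc zero)) = complement-adj G (x≢b ∘ sym) b?x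
    deg<3 : degree (complement G) b ℕ.< 3
    deg<3 = subst (ℕ._< 3) (sym deg-b) (n<1+n 2)
  ...   | zero , suc zero , _ , a≡c = ⊥-elim (a≢c a≡c)
  ...   | zero , suc (suc zero) , _ , a≡x = ⊥-elim (x≢a (sym a≡x))
  ...   | suc zero , suc (suc zero) , _ , c≡x = ⊥-elim (x≢c (sym c≡x))
  ...   | suc _ , suc zero , s≤s () , _
  ...   | suc (suc _) , suc (suc zero) , s≤s (s≤s ()) , _

  a~c : adj G a c ≡ true
  a~c = trans (adj-sym G a c) (c-adjacent a a≢b a≢c)

  G₁ : Graph (suc n)
  G₁ = addVertex G (λ _ → true)

  G₂ : Graph (suc (suc n))
  G₂ = addVertex G₁ (allBut a)

  module Oriented (O : Orientation G) (perfect : OnePerfect O) (a→c : arc O a c ≡ true) where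

    into-b : ∀ x → x ≢ a → x ≢ b → x ≢ c → arc O b x ≡ false → arc O x b ≡ true
    into-b x x≢a x≢b x≢c = arc-reverse O (b-adjacent x x≢a x≢b x≢c)

    into-c : ∀ x → x ≢ b → x ≢ c → arc O c x ≡ false → arc O x c ≡ true
    into-c x x≢b x≢c = arc-reverse O (c-adjacent x x≢b x≢c)

    out[c′] : Fin n → Bool
    out[c′] y = (y == b) ∨ arc O c y

    -- a ∉ out(c) is exactly where the reorientation a → c is needed.
    b~out[c] : ∀ y → arc O c y ≡ true → y ≢ b → adj G b y ≡ true
    b~out[c] y c→y y≢b =
      b-adjacent y (λ { refl → true≢false c→y (arc-anti O a c a→c) }) y≢b (arc⇒≢ O c→y ∘ sym)

    module AddC′ = Extension O (λ _ → true) out[c′] (λ _ _ → refl)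

    O₁ : Orientation G₁
    O₁ = AddC′.extend

    perfect₁ : OnePerfect O₁
    perfect₁ = AddC′.extend-perfect perfect (insert-out-clique O perfect c b b~out[c]) (λ _ _ _ _ _ → refl)

    out[b′] : Fin (suc n) → Bool
    out[b′] zero    = false
    out[b′] (suc y) = (y == c) ∨ arc O b y

    out[b′]⊆allBut : ∀ y → out[b′] y ≡ true → allBut a y ≡ true
    out[b′]⊆allBut (suc y) e with ∨-true {y == c} e
    ... | inj₁ y=c = ≢⇒not==-true {x = y} (λ y≡a → a≢c (trans (sym y≡a) (==⇒≡ y=c)))
    ... | inj₂ b→y = ≢⇒not==-true {x = y} (λ { refl → true≢false (arc⊆adj O b y b→y) b≁a })

    out[b′]-clique : IsClique G₁ out[b′]
    out[b′]-clique (suc x) (suc y) ex ey sx≢sy =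
      insert-out-clique O perfect b c (λ y b→y y≢c → c-adjacent y (arc⇒≢ O b→y ∘ sym) y≢c)
        x y ex ey (sx≢sy ∘ cong suc)

    -- An in-neighbour x ≠ b of b′ points to b, hence to neither of its non-neighbours a and c.
    in-closed₂ : ∀ x y → allBut a x ≡ true → out[b′] x ≡ false → arc O₁ x y ≡ true → allBut a y ≡ true
    in-closed₂ (suc x) zero x≠a ¬b′→x x→c′ =
      let x≠c , b↛x = ∨-false ¬b′→x
          x≠b , c↛x = ∨-false (not-true x→c′)
          x≢a = not==-true⇒≢ x≠a ; x≢b = ==-false⇒≢ x≠b ; x≢c = ==-false⇒≢ x≠c
      in ⊥-elim (true≢false (perfect x b c (into-b x x≢a x≢b x≢c b↛x) (into-c x x≢b x≢c c↛x) b≢c) b≁c)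
    in-closed₂ (suc x) (suc y) x≠a ¬b′→x x→y with toSum (y ≟ a) | toSum (x ≟ b)
    ... | inj₂ y≢a  | _         = ≢⇒not==-true y≢a
    ... | inj₁ refl | inj₁ refl = ⊥-elim (true≢false (arc⊆adj O b y x→y) b≁a)
    ... | inj₁ refl | inj₂ x≢b =
      let x≠c , b↛x = ∨-false ¬b′→x
          x→b = into-b x (not==-true⇒≢ x≠a) x≢b (==-false⇒≢ x≠c) b↛x
      in ⊥-elim (true≢false (perfect x b y x→b x→y (a≢b ∘ sym)) b≁a)

    module AddB′ = Extension O₁ (allBut a) out[b′] out[b′]⊆allBut

    O₂ : Orientation G₂
    O₂ = AddB′.extend

    perfect₂ : OnePerfect O₂
    perfect₂ = AddB′.extend-perfect perfect₁ out[b′]-clique in-closed₂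

  G₂-orientable : OnePerfectlyOrientable G → OnePerfectlyOrientable G₂
  G₂-orientable (O , perfect) = O₂ , perfect₂
    where
    c~out[a] : ∀ y → arc O a y ≡ true → y ≢ c → adj G c y ≡ true
    c~out[a] y a→y = c-adjacent y (λ { refl → true≢false (arc⊆adj O a b a→y) a≁b })

    open Reorientation O a~c
    open Oriented reorient (reorient-perfect perfect c~out[a]) reorient-arc

duplicate2BranchCompl-orientable : (G : Graph n) (a b c : Fin n) (br : Is2Branch (complement G) a b c) →
                                   OnePerfectlyOrientable G →
                                   OnePerfectlyOrientable (duplicate2BranchCompl G a b c br)
duplicate2BranchCompl-orientable G a b c br@(a≢b , b≢c , a≢c , co-ab , co-bc , deg-b , deg-c) =
  pullback-orientable G₂ (duplicate2BranchCompl G a b c br) id id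
    (duplicate2BranchCompl-adj G a b c br) ∘ G₂-orientable
  where open DuplicateCoBranch G a≢b b≢c a≢c co-ab co-bc deg-b deg-c

theorem6 :
    (∀ {m n} (G : Graph m) (H : Graph n) →
       OnePerfectlyOrientable G → OnePerfectlyOrientable H →
       OnePerfectlyOrientable (disjointUnion G H))
  × (∀ {n} (G : Graph n) →
       OnePerfectlyOrientable G → OnePerfectlyOrientable (addUniversal G))
  × (∀ {n} (G : Graph n) (w : Fin n) →
       OnePerfectlyOrientable G → OnePerfectlyOrientable (addTrueTwin G w))
  × (∀ {n} (G : Graph n) (S : Fin n → Bool) (cl : IsClique G S) →
       OnePerfectlyOrientable G → OnePerfectlyOrientable (addSimplicial G S cl))
  × (∀ {n} (G : Graph n) (a b c : Fin n) (br : Is2Branch (complement G) a b c) →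
       OnePerfectlyOrientable G →
       OnePerfectlyOrientable (duplicate2BranchCompl G a b c br))
  × (∀ {n} (G : Graph (suc n)) (v : Fin (suc n)) →
       OnePerfectlyOrientable G → OnePerfectlyOrientable (deleteVertex G v))
  × (∀ {n} (G : Graph (suc n)) (u v : Fin (suc n)) (e : adj G u v ≡ true) →
       OnePerfectlyOrientable G → OnePerfectlyOrientable (contractEdge G u v e))
theorem6 =
    disjointUnion-orientable
  , addUniversal-orientable
  , addTrueTwin-orientable
  , addSimplicial-orientable
  , duplicate2BranchCompl-orientable
  , deleteVertex-orientable
  , contractEdge-orientable
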